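{- Let $a,h,d,k,K$ be positive integers with $\gcd(a,d)=1$ and $K-1>k\ge2$, and let $A(a)=(a,ha+d,ha+2d,\dots,ha+kd,ha+Kd)$. Write $K=sk+t$ with $0\le t\le k-1$ and $s\ge1$, and let $Q=\left\lfloor\frac{a}{K}\right\rfloor$; let $j$ denote the residue of $a$ modulo $K$, $0\le j\le K-1$. (i) If $2\le t\le k-1$, $h\ge\left\lceil\frac ds\right\rceil$ and $a\ge sK$, then $$g(A(a))=\begin{cases}(Q+s)ha+KdQ-a-d & \text{if } j\in\{0,1,\dots,(s-1)k+1\},\\ (Q+s)ha+KdQ-a+(j-1)d & \text{if } j\in\{(s-1)k+2,\dots,sk+1\},\\ (Q+s+1)ha+KdQ-a+(j-1)d & \text{if } j\in\{sk+2,\dots,K-1\}.\end{cases}$$ (ii) If $t\in\{0,1\}$, $h\ge\left\lceil\frac{d}{s-1}\right\rceil$ and $a\ge(s-1)K$, then $$g(A(a))=\begin{cases}(Q+s-1)ha+KdQ-a-d & \text{if } j\in\{0,1,\dots,(s-2)k+1\},\\ (Q+s-1)ha+KdQ-a+(j-1)d & \text{if } j\in\{(s-2)k+2,\dots,(s-1)k+1\},\\ (Q+s)ha+KdQ-a+(j-1)d & \text{if } j\in\{(s-1)k+2,\dots,K-1\}.\end{cases}$$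
   Context: For positive integers $a_1,\dots,a_n$ with $\gcd=1$, the Frobenius number $g(a_1,\dots,a_n)$ is the largest integer not representable as $\sum x_ia_i$ with nonnegative integers $x_i$. -}

module Defs where

open import Data.Nat using (ℕ; zero; suc; _+_; _*_; _∸_)
open import Data.Nat.DivMod using (_/_)
open import Data.List using (List; []; _∷_; _++_; [_]; map; applyUpTo; zipWith; length)
open import Data.Nat.ListAction using (sum)
open import Data.Integer using (ℤ; +_; _<_)
open import Data.Product using (Σ; _×_)
open import Relation.Nullary using (¬_)
open import Relation.Binary.PropositionalEquality using (_≡_)

Representable : List ℕ → ℤ → Set
Representable as z =
  Σ (List ℕ) λ xs → (length xs ≡ length as) × (+ (sum (zipWith _*_ xs as)) ≡ z)

IsFrobeniusNumber : List ℕ → ℤ → Set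
IsFrobeniusNumber as g = ¬ Representable as g × (∀ (m : ℤ) → g < m → Representable as m)

-- ceiling division ⌈ m / n ⌉ (convention: value 0 when n = 0; never used there)
⌈_/_⌉ : ℕ → ℕ → ℕ
⌈ m / zero ⌉ = 0
⌈ m / suc n ⌉ = (m + n) / suc n

A : ℕ → ℕ → ℕ → ℕ → ℕ → List ℕ
A a h d k K = a ∷ (applyUpTo (λ i → h * a + suc i * d) k ++ [ h * a + K * d ])

module Submission where

-- A representable number is x₀·a + z·ha + W·d + y·(ha + Kd) with W ≤ zk (z of the generators ha + id, 1 ≤ i ≤ k, and
-- y copies of ha + Kd), so modulo a it is (W + yK)·d; as gcd(a, d) = 1 the classes modulo a are the w·d with w < a.
-- Hence G is the Frobenius number once G + a = M·ha + w·d is the least representable element of its class and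
-- every other class has a representable element ≤ G + a. Minimality holds when every writing w = W + yK costs at
-- least M generators (the cost of qK + r with r < K is q + ⌈r/k⌉, as k ≤ K) and passing to w + a never pays off
-- (MK < w + a + K); the other classes are cheap enough because Kd ≤ ha, which is where h ≥ ⌈d/σ⌉ and a ≥ σK enter.
-- With σ = s, Q = ⌊a/K⌋ and j = a mod K the extremal class is w = QK − 1, of cost Q + σ, when j ≤ (σ − 1)k + 1, and
-- w = a − 1, of cost Q + σ or Q + σ + 1, otherwise. Part (ii) is the same computation for σ = s − 1, K = σk + (k + t).

open import Defs
open import Data.Nat using (ℕ; NonZero; _≤_; _<_; _∸_; _≥_)
open import Data.Nat.DivMod using (_/_; _%_)
open import Data.Nat.GCD using (gcd)
open import Data.Product using (_×_)
open import Data.Sum using (_⊎_)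
open import Relation.Binary.PropositionalEquality using (_≡_)

module _ where
  open import Data.Empty using (⊥; ⊥-elim)
  open import Data.Integer as ℤ using (-[1+_]; +<+)
  import Data.Integer.Properties as ℤP
  open import Data.List using (List; []; _∷_; _++_; [_]; applyUpTo; zipWith; length; replicate)
  open import Data.List.Membership.Propositional using (_∈_)
  open import Data.List.Membership.Propositional.Properties using (∈-applyUpTo⁺; ∈-++⁺ˡ; ∈-++⁺ʳ)
  open import Data.List.Properties using (length-applyUpTo; length-replicate)
  open import Data.List.Relation.Unary.Any using (here; there)
  open import Data.Nat
  open import Data.Nat.Coprimality using (Coprime; coprime-divisor; coprime-Bézout)
  open import Data.Nat.DivMod using (m≡m%n+[m/n]*n; m%n<n)
  open import Data.Nat.Divisibility using (_∣_; divides; ∣m+n∣m⇒∣n; ∣⇒≤)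
  open import Data.Nat.GCD using (module Bézout)
  open import Data.Nat.ListAction using (sum)
  open import Data.Nat.Properties
  open import Data.Nat.Tactic.RingSolver using (solve-∀)
  open import Data.Product using (Σ; _,_)
  open import Relation.Nullary using (¬_; yes; no)
  open import Relation.Binary.PropositionalEquality hiding ([_])

  Representableℕ : List ℕ → ℕ → Set
  Representableℕ as n = Σ (List ℕ) λ xs → length xs ≡ length as × sum (zipWith _*_ xs as) ≡ n

  combination-replicate-0 : ∀ as → sum (zipWith _*_ (replicate (length as) 0) as) ≡ 0
  combination-replicate-0 []       = refl
  combination-replicate-0 (_ ∷ as) = combination-replicate-0 as

  combination-+ : ∀ as xs ys → length xs ≡ length as → length ys ≡ length as →
    length (zipWith _+_ xs ys) ≡ length as ×
    sum (zipWith _*_ (zipWith _+_ xs ys) as) ≡ sum (zipWith _*_ xs as) + sum (zipWith _*_ ys as)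
  combination-+ []       []       []       _ _ = refl , refl
  combination-+ (α ∷ as) (x ∷ xs) (y ∷ ys) p q
    with length≡ , sum≡ ← combination-+ as xs ys (suc-injective p) (suc-injective q) =
    cong suc length≡ , trans (cong (((x + y) * α) +_) sum≡) (regroup x y α _ _)
    where
    regroup : ∀ x y α u v → (x + y) * α + (u + v) ≡ (x * α + u) + (y * α + v)
    regroup = solve-∀

  representable-0 : ∀ as → Representableℕ as 0
  representable-0 as = replicate (length as) 0 , length-replicate (length as) , combination-replicate-0 as

  representable-+ : ∀ {as m n} → Representableℕ as m → Representableℕ as n → Representableℕ as (m + n)
  representable-+ {as} (xs , p , refl) (ys , q , refl) =
    let length≡ , sum≡ = combination-+ as xs ys p q in zipWith _+_ xs ys , length≡ , sum≡

  representable-* : ∀ {as n} c → Representableℕ as n → Representableℕ as (c * n)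
  representable-* {as} zero    _   = representable-0 as
  representable-* (suc c) rep = representable-+ rep (representable-* c rep)

  representable-∈ : ∀ {as g} → g ∈ as → Representableℕ as g
  representable-∈ {g ∷ as} (here refl) =
    1 ∷ replicate (length as) 0 , cong suc (length-replicate (length as)) ,
    trans (cong₂ _+_ (*-identityˡ g) (combination-replicate-0 as)) (+-identityʳ g)
  representable-∈ {_ ∷ _} (there g∈as) =
    let xs , p , e = representable-∈ g∈as in 0 ∷ xs , cong suc p , e

  combination-∷ʳ : ∀ us v xs → length xs ≡ length (us ++ [ v ]) →
    Σ (List ℕ) λ xs′ → Σ ℕ λ y → length xs′ ≡ length us ×
      sum (zipWith _*_ xs (us ++ [ v ])) ≡ sum (zipWith _*_ xs′ us) + y * v
  combination-∷ʳ []       v (y ∷ [])  _ = [] , y , refl , +-identityʳ (y * v)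
  combination-∷ʳ (u ∷ us) v (x ∷ xs) p
    with xs′ , y , q , e ← combination-∷ʳ us v xs (suc-injective p) =
    x ∷ xs′ , y , cong suc q , trans (cong ((x * u) +_) e) (sym (+-assoc (x * u) _ _))

  combination-affine : ∀ n xs (g : ℕ → ℕ) c d b → length xs ≡ n → (∀ i → i < n → g i ≤ b) →
    Σ ℕ λ W → W ≤ sum xs * b × sum (zipWith _*_ xs (applyUpTo (λ i → c + g i * d) n)) ≡ sum xs * c + W * d
  combination-affine zero    []       g c d b _ _ = 0 , z≤n , refl
  combination-affine (suc n) (x ∷ xs) g c d b p g≤b
    with W , W≤ , e ← combination-affine n xs (λ i → g (suc i)) c d b (suc-injective p) (λ i i<n → g≤b (suc i) (s≤s i<n)) =
    x * g 0 + W ,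
    subst (x * g 0 + W ≤_) (sym (*-distribʳ-+ b x (sum xs))) (+-mono-≤ (*-monoʳ-≤ x (g≤b 0 z<s)) W≤) ,
    trans (cong ((x * (c + g 0 * d)) +_) e) (regroup x (g 0) c d (sum xs) W)
    where
    regroup : ∀ x g₀ c d S W → x * (c + g₀ * d) + (S * c + W * d) ≡ (x + S) * c + (x * g₀ + W) * d
    regroup = solve-∀

  coprime-shift : ∀ {a d P e R} .{{_ : NonZero a}} → Coprime a d → P * a + e * d ≡ R * a →
    Σ ℕ λ l → e ≡ l * a × R ≡ P + l * d
  coprime-shift {a} {d} {P} {e} {R} cop eq
    with divides l e≡la ← coprime-divisor cop (subst (a ∣_) (*-comm e d) (∣m+n∣m⇒∣n (divides R eq) (divides P refl))) =
    l , e≡la , *-cancelʳ-≡ R (P + l * d) a (begin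
      R * a                 ≡⟨ eq ⟨
      P * a + e * d         ≡⟨ cong (λ e → P * a + e * d) e≡la ⟩
      P * a + l * a * d     ≡⟨ regroup P l a d ⟩
      (P + l * d) * a       ∎)
    where
    open ≡-Reasoning
    regroup : ∀ P l a d → P * a + l * a * d ≡ (P + l * d) * a
    regroup = solve-∀

  coprime-lincomb-unique : ∀ {a d P U R V} → Coprime a d → V < a → P * a + U * d ≡ R * a + V * d →
    Σ ℕ λ l → U ≡ V + l * a × R ≡ P + l * d
  coprime-lincomb-unique {a} {d} {P} {U} {R} {V} cop V<a eq with V ≤? U
  ... | yes V≤U with e , refl ← m≤n⇒∃[o]m+o≡n V≤U =
    let l , e≡la , R≡ = coprime-shift {{a-nonZero}} cop (+-cancelʳ-≡ (V * d) _ _ (trans (regroup P a V e d) eq))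
    in l , cong (V +_) e≡la , R≡
    where
    a-nonZero : NonZero a
    a-nonZero = >-nonZero (≤-<-trans z≤n V<a)
    regroup : ∀ P a V e d → P * a + e * d + V * d ≡ P * a + (V + e) * d
    regroup = solve-∀
  ... | no V≰U with e , refl ← m≤n⇒∃[o]m+o≡n (≰⇒> V≰U) =
    ⊥-elim (<⇒≱ (≤-<-trans (s≤s (m≤n+m e U)) V<a) (∣⇒≤ a∣1+e))
    where
    a∣1+e : a ∣ suc e
    a∣1+e = coprime-divisor cop (subst (a ∣_) (*-comm (suc e) d) (∣m+n∣m⇒∣n
      (divides P (+-cancelʳ-≡ (U * d) _ _ (trans (regroup R a U e d) (sym eq)))) (divides R refl)))
      where
      regroup : ∀ R a U e d → R * a + suc e * d + U * d ≡ R * a + (suc U + e) * d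
      regroup = solve-∀

  modular-inverse : ∀ {a d} .{{_ : NonZero a}} → Coprime a d →
    Σ ℕ λ e → Σ ℕ λ X → Σ ℕ λ Y → 1 + X * a ≡ e * d + Y * a
  modular-inverse cop with coprime-Bézout cop
  ... | Bézout.-+ x y eq = y , x , 0 , trans eq (sym (+-identityʳ _))
  modular-inverse {suc a} {d} cop | Bézout.+- x y eq =
    a * y , a * x , 1 , trans (regroup₁ a x) (trans (cong (λ v → 1 + a * v) (sym eq)) (regroup₂ a y d))
    where
    regroup₁ : ∀ a x → 1 + a * x * suc a ≡ 1 + a * (x * suc a)
    regroup₁ = solve-∀
    regroup₂ : ∀ a y d → 1 + a * (1 + y * d) ≡ a * y * d + 1 * suc a
    regroup₂ = solve-∀

  residue-representative : ∀ {a d} .{{_ : NonZero a}} → Coprime a d → ∀ n →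
    Σ ℕ λ w → Σ ℕ λ X → Σ ℕ λ Y → w < a × n + X * a ≡ w * d + Y * a
  residue-representative {a} {d} cop n with e , X , Y , inverse ← modular-inverse cop =
    (n * e) % a , n * X , (n * e) / a * d + n * Y , m%n<n (n * e) a , (begin
      n + n * X * a                             ≡⟨ regroup₁ n X a ⟩
      n * (1 + X * a)                           ≡⟨ cong (n *_) inverse ⟩
      n * (e * d + Y * a)                       ≡⟨ regroup₂ n e d Y a ⟩
      n * e * d + n * Y * a                     ≡⟨ cong (λ v → v * d + n * Y * a) (m≡m%n+[m/n]*n (n * e) a) ⟩
      ((n * e) % a + (n * e) / a * a) * d + n * Y * a ≡⟨ regroup₃ ((n * e) % a) ((n * e) / a) a d (n * Y) ⟩
      (n * e) % a * d + ((n * e) / a * d + n * Y) * a ∎)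
    where
    open ≡-Reasoning
    regroup₁ : ∀ n X a → n + n * X * a ≡ n * (1 + X * a)
    regroup₁ = solve-∀
    regroup₂ : ∀ n e d Y a → n * (e * d + Y * a) ≡ n * e * d + n * Y * a
    regroup₂ = solve-∀
    regroup₃ : ∀ w q a d nY → (w + q * a) * d + nY * a ≡ w * d + (q * d + nY) * a
    regroup₃ = solve-∀

  congruent-below⇒multiple-above : ∀ {n X T Y a} → n + X * a ≡ T + Y * a → T < n + a → Σ ℕ λ x → n ≡ T + x * a
  congruent-below⇒multiple-above {n} {X} {T} {Y} {a} eq T<n+a with X ≤? Y
  ... | yes X≤Y with D , refl ← m≤n⇒∃[o]m+o≡n X≤Y =
    D , +-cancelʳ-≡ (X * a) n (T + D * a) (trans eq (regroup T X D a))
    where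
    regroup : ∀ T X D a → T + (X + D) * a ≡ T + D * a + X * a
    regroup = solve-∀
  ... | no X≰Y with D , refl ← m≤n⇒∃[o]m+o≡n (≰⇒> X≰Y) =
    ⊥-elim (<⇒≱ T<n+a (subst (n + a ≤_) (+-cancelʳ-≡ (Y * a) _ _ (trans (regroup n a D Y) eq)) (m≤m+n (n + a) (D * a))))
    where
    regroup : ∀ n a D Y → n + a + D * a + Y * a ≡ n + (suc Y + D) * a
    regroup = solve-∀

  module Generators (a h d k K : ℕ) where

    a∈A : a ∈ A a h d k K
    a∈A = here refl

    step∈A : ∀ {i} → 1 ≤ i → i ≤ k → h * a + i * d ∈ A a h d k K
    step∈A {suc i} _ i<k = there (∈-++⁺ˡ (∈-applyUpTo⁺ (λ i → h * a + suc i * d) i<k))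

    top∈A : h * a + K * d ∈ A a h d k K
    top∈A = there (∈-++⁺ʳ (applyUpTo (λ i → h * a + suc i * d) k) (here refl))

    representable-steps : 1 ≤ k → ∀ c r → r ≤ c * k →
      Σ ℕ λ c′ → c′ ≤ c × Representableℕ (A a h d k K) (c′ * (h * a) + r * d)
    representable-steps _   zero    .0 z≤n = 0 , z≤n , representable-0 _
    representable-steps 1≤k (suc c) r r≤ with r ≤? k
    ... | yes r≤k = at-most-one-step r r≤k
      where
      at-most-one-step : ∀ r → r ≤ k → Σ ℕ λ c′ → c′ ≤ suc c × Representableℕ (A a h d k K) (c′ * (h * a) + r * d)
      at-most-one-step zero    _   = 0 , z≤n , representable-0 _
      at-most-one-step (suc u) u<k =
        1 , s≤s z≤n , subst (Representableℕ (A a h d k K)) (cong (_+ suc u * d) (sym (*-identityˡ (h * a))))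
                        (representable-∈ (step∈A (s≤s z≤n) u<k))
    ... | no r≰k with r′ , refl ← m≤n⇒∃[o]m+o≡n (<⇒≤ (≰⇒> r≰k))
        with c′ , c′≤c , rep ← representable-steps 1≤k c r′ (+-cancelˡ-≤ k _ _ r≤) =
      suc c′ , s≤s c′≤c ,
      subst (Representableℕ (A a h d k K)) (regroup (h * a) k d c′ r′)
        (representable-+ (representable-∈ (step∈A 1≤k ≤-refl)) rep)
      where
      regroup : ∀ x k d c r → x + k * d + (c * x + r * d) ≡ suc c * x + (k + r) * d
      regroup = solve-∀

    representation-shape : ∀ {n} → Representableℕ (A a h d k K) n →
      Σ ℕ λ x₀ → Σ ℕ λ z → Σ ℕ λ y → Σ ℕ λ W → W ≤ z * k ×
        n ≡ x₀ * a + z * (h * a) + W * d + y * (h * a + K * d)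
    representation-shape (x₀ ∷ xs , p , refl)
      with xs′ , y , q , split ← combination-∷ʳ (applyUpTo (λ i → h * a + suc i * d) k) (h * a + K * d) xs (suc-injective p)
      with W , W≤ , steps ← combination-affine k xs′ suc (h * a) d k (trans q (length-applyUpTo _ k)) (λ _ i<k → i<k) =
      x₀ , sum xs′ , y , W , W≤ ,
      trans (cong ((x₀ * a) +_) (trans split (cong (_+ y * (h * a + K * d)) steps))) (regroup (x₀ * a) _ _ _)
      where
      regroup : ∀ u v w x → u + ((v + w) + x) ≡ u + v + w + x
      regroup = solve-∀

    representable-congruent : ∀ {n X T Y} → Representableℕ (A a h d k K) T →
      n + X * a ≡ T + Y * a → T < n + a → Representableℕ (A a h d k K) n
    representable-congruent {n} {X} {T} {Y} rep congruent T<n+a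
      with x , refl ← congruent-below⇒multiple-above {n} {X} {T} {Y} {a} congruent T<n+a =
      representable-+ rep (representable-* x (representable-∈ a∈A))

  module FrobeniusCriterion (a h d k K : ℕ) .{{_ : NonZero a}} (1≤k : 1 ≤ k) (k≤K : k ≤ K) (cop : Coprime a d) where
    open Generators a h d k K

    -- w < a stands for the class of w·d modulo a; the class of w′ = qK + r is witnessed by q copies of ha + Kd and at
    -- most c generators ha + id with indices summing to r.
    ResiduesCovered : ℕ → ℕ → Set
    ResiduesCovered M w = ∀ w′ → w′ < a → Σ ℕ λ q → Σ ℕ λ r → Σ ℕ λ c →
      w′ ≡ q * K + r × r ≤ c * k × (q + c) * h * a + w′ * d ≤ M * h * a + w * d

    NeedsAtLeast : ℕ → ℕ → Set
    NeedsAtLeast M w = ∀ y z W → W ≤ z * k → W + y * K ≡ w → M ≤ z + y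

    not-representable : ∀ {G M w} → G + a ≡ M * h * a + w * d → w < a → NeedsAtLeast M w → M * K < w + a + K →
      ¬ Representableℕ (A a h d k K) G
    not-representable {G} {M} {w} G+a≡ w<a needs MK< rep
      with x₀ , z , y , W , W≤zk , G≡ ← representation-shape rep
      = excess-mismatch (coprime-lincomb-unique {P = suc (x₀ + (z + y) * h)} {W + y * K} {M * h} {w} cop w<a lincomb)
      where
      lincomb : suc (x₀ + (z + y) * h) * a + (W + y * K) * d ≡ M * h * a + w * d
      lincomb = begin
        suc (x₀ + (z + y) * h) * a + (W + y * K) * d           ≡⟨ regroup x₀ z y h a W d K ⟩
        x₀ * a + z * (h * a) + W * d + y * (h * a + K * d) + a ≡⟨ cong (_+ a) G≡ ⟨
        G + a                                                  ≡⟨ G+a≡ ⟩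
        M * h * a + w * d                                      ∎
        where
        open ≡-Reasoning
        regroup : ∀ x₀ z y h a W d K →
          suc (x₀ + (z + y) * h) * a + (W + y * K) * d ≡ x₀ * a + z * (h * a) + W * d + y * (h * a + K * d) + a
        regroup = solve-∀
      z+y<M : ∀ l → M * h ≡ suc (x₀ + (z + y) * h) + l * d → z + y < M
      z+y<M l Mh≡ =
        *-cancelʳ-< h (z + y) M (subst ((z + y) * h <_) (sym Mh≡) (s≤s (≤-trans (m≤n+m _ x₀) (m≤m+n _ (l * d)))))
      excess-mismatch : (Σ ℕ λ l → W + y * K ≡ w + l * a × M * h ≡ suc (x₀ + (z + y) * h) + l * d) → ⊥
      excess-mismatch (zero  , eq , Mh≡) = <⇒≱ (z+y<M 0 Mh≡) (needs y z W W≤zk (trans eq (+-identityʳ w)))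
      excess-mismatch (suc l , eq , Mh≡) = <⇒≱ MK< (begin
        w + a + K                ≤⟨ +-monoˡ-≤ K (+-monoʳ-≤ w (m≤m+n a (l * a))) ⟩
        w + suc l * a + K        ≡⟨ cong (_+ K) eq ⟨
        W + y * K + K            ≤⟨ +-monoˡ-≤ K (+-monoˡ-≤ (y * K) (≤-trans W≤zk (*-monoʳ-≤ z k≤K))) ⟩
        z * K + y * K + K        ≡⟨ regroup z y K ⟩
        suc (z + y) * K          ≤⟨ *-monoˡ-≤ K (z+y<M (suc l) Mh≡) ⟩
        M * K                    ∎)
        where
        open ≤-Reasoning
        regroup : ∀ z y K → z * K + y * K + K ≡ suc (z + y) * K
        regroup = solve-∀

    representable-above : ∀ {G M w} → G + a ≡ M * h * a + w * d → ResiduesCovered M w →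
      ∀ n → G < n → Representableℕ (A a h d k K) n
    representable-above {G} {M} {w} G+a≡ covered n G<n
      with w′ , X , Y , w′<a , n≡ ← residue-representative cop n
      with q , r , c , refl , r≤ck , cost≤ ← covered w′ w′<a
      with c′ , c′≤c , steps ← representable-steps 1≤k c r r≤ck
      = representable-congruent {X = X + (q + c′) * h} {Y = Y}
          (representable-+ (representable-* q (representable-∈ top∈A)) steps) congruence T<n+a
      where
      T≡ : q * (h * a + K * d) + (c′ * (h * a) + r * d) ≡ (q + c′) * h * a + (q * K + r) * d
      T≡ = regroup q h a K d c′ r
        where
        regroup : ∀ q h a K d c r → q * (h * a + K * d) + (c * (h * a) + r * d) ≡ (q + c) * h * a + (q * K + r) * d
        regroup = solve-∀
      congruence : n + (X + (q + c′) * h) * a ≡ q * (h * a + K * d) + (c′ * (h * a) + r * d) + Y * a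
      congruence = trans (regroup n X (q + c′) h a) (trans (cong (_+ (q + c′) * h * a) n≡)
        (trans (regroup′ ((q * K + r) * d) (Y * a) ((q + c′) * h * a)) (cong (_+ Y * a) (sym T≡))))
        where
        regroup : ∀ n X c h a → n + (X + c * h) * a ≡ n + X * a + c * h * a
        regroup = solve-∀
        regroup′ : ∀ u v w → u + v + w ≡ w + u + v
        regroup′ = solve-∀
      T<n+a : q * (h * a + K * d) + (c′ * (h * a) + r * d) < n + a
      T<n+a = begin-strict
        q * (h * a + K * d) + (c′ * (h * a) + r * d) ≡⟨ T≡ ⟩
        (q + c′) * h * a + (q * K + r) * d           ≤⟨ +-monoˡ-≤ _ (*-monoˡ-≤ a (*-monoˡ-≤ h (+-monoʳ-≤ q c′≤c))) ⟩
        (q + c) * h * a + (q * K + r) * d            ≤⟨ cost≤ ⟩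
        M * h * a + w * d                            ≡⟨ G+a≡ ⟨
        G + a                                        <⟨ +-monoˡ-< a G<n ⟩
        n + a                                        ∎
        where open ≤-Reasoning

    frobenius-criterion : ∀ {G M w} → G + a ≡ M * h * a + w * d → w < a → ResiduesCovered M w → NeedsAtLeast M w →
      M * K < w + a + K → IsFrobeniusNumber (A a h d k K) (ℤ.+ G)
    frobenius-criterion {G} {M} {w} G+a≡ w<a covered needs MK< =
      (λ (xs , p , e) → not-representable {G} {M} {w} G+a≡ w<a needs MK< (xs , p , ℤP.+-injective e)) , above
      where
      above : ∀ m → ℤ.+ G ℤ.< m → Representable (A a h d k K) m
      above -[1+ _ ] ()
      above (ℤ.+ n) (+<+ G<n) = let xs , p , e = representable-above {G} {M} {w} G+a≡ covered n G<n in xs , p , cong ℤ.+_ e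

  steps-lower-bound : ∀ {k K} q r s → k ≤ K → r < K → s * k < r + k →
    ∀ y z W → W ≤ z * k → W + y * K ≡ q * K + r → q + s ≤ z + y
  steps-lower-bound {k} {K} q r s k≤K r<K sk<r+k y z W W≤zk eq with y ≤? q
  ... | no y≰q = ⊥-elim (<⇒≱ (subst (q * K + r <_) (+-comm (q * K) K) (+-monoʳ-< (q * K) r<K))
                              (≤-trans (*-monoˡ-≤ K (≰⇒> y≰q)) (≤-trans (m≤n+m (y * K) W) (≤-reflexive eq))))
  ... | yes y≤q with e , refl ← m≤n⇒∃[o]m+o≡n y≤q with e + s ≤? z
  ...   | yes e+s≤z = subst (_≤ z + y) (regroup y e s) (+-monoˡ-≤ y e+s≤z)
    where
    regroup : ∀ y e s → e + s + y ≡ y + e + s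
    regroup = solve-∀
  ...   | no e+s≰z = ⊥-elim (<⇒≱ zk<ek+r (≤-trans (+-monoˡ-≤ r (*-monoʳ-≤ e k≤K)) (subst (_≤ z * k) W≡ W≤zk)))
    where
    W≡ : W ≡ e * K + r
    W≡ = +-cancelʳ-≡ (y * K) W (e * K + r) (trans eq (regroup y e K r))
      where
      regroup : ∀ y e K r → (y + e) * K + r ≡ e * K + r + y * K
      regroup = solve-∀
    zk<ek+r : z * k < e * k + r
    zk<ek+r = +-cancelʳ-< k (z * k) (e * k + r) (begin-strict
      z * k + k      ≡⟨ +-comm (z * k) k ⟩
      suc z * k      ≤⟨ *-monoˡ-≤ k (≰⇒> e+s≰z) ⟩
      (e + s) * k    ≡⟨ *-distribʳ-+ k e s ⟩
      e * k + s * k  <⟨ +-monoʳ-< (e * k) sk<r+k ⟩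
      e * k + (r + k) ≡⟨ +-assoc (e * k) r k ⟨
      e * k + r + k  ∎)
      where open ≤-Reasoning

  <-≤+1⇒≤ : ∀ {r j m} → r < j → j ≤ m + 1 → r ≤ m
  <-≤+1⇒≤ {r} {j} {m} r<j j≤m+1 = ≤-pred (subst (suc r ≤_) (+-comm m 1) (≤-trans r<j j≤m+1))

  ⌈/⌉≤⇒≤* : ∀ {m n h} → 1 ≤ n → ⌈ m / n ⌉ ≤ h → m ≤ h * n
  ⌈/⌉≤⇒≤* {m} {suc n} {h} _ ⌈m/n⌉≤h = +-cancelʳ-≤ n m (h * suc n)
    (≤-trans (≤-reflexive (m≡m%n+[m/n]*n (m + n) (suc n)))
      (subst ((m + n) % suc n + (m + n) / suc n * suc n ≤_) (+-comm n (h * suc n))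
        (+-mono-≤ (≤-pred (m%n<n (m + n) (suc n))) (*-monoˡ-≤ (suc n) ⌈m/n⌉≤h))))

  module Configuration (a h d k K σ₀ t Q j : ℕ) .{{_ : NonZero K}} (cop : Coprime a d) (1≤h : 1 ≤ h) (1≤k : 1 ≤ k)
    (K≡ : K ≡ suc σ₀ * k + t) (2≤t : 2 ≤ t) (t≤1+k : t ≤ suc k) (d≤hσ : d ≤ h * suc σ₀)
    (σK≤a : suc σ₀ * K ≤ a) (a≡ : a ≡ j + Q * K) (j<K : j < K) where

    σ : ℕ
    σ = suc σ₀

    σk+2≤K : σ * k + 2 ≤ K
    σk+2≤K = subst (σ * k + 2 ≤_) (sym K≡) (+-monoʳ-≤ (σ * k) 2≤t)

    k≤K : k ≤ K
    k≤K = ≤-trans (m≤m+n k (σ₀ * k)) (≤-trans (m≤m+n (σ * k) 2) σk+2≤K)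

    2≤K : 2 ≤ K
    2≤K = ≤-trans (m≤n+m 2 (σ * k)) σk+2≤K

    K≤a : K ≤ a
    K≤a = ≤-trans (m≤m+n K (σ₀ * K)) σK≤a

    instance
      a-nonZero : NonZero a
      a-nonZero = >-nonZero (≤-trans 1≤k (≤-trans k≤K K≤a))

    open FrobeniusCriterion a h d k K 1≤k k≤K cop

    Kd≤ha : K * d ≤ h * a
    Kd≤ha = begin
      K * d        ≤⟨ *-monoʳ-≤ K d≤hσ ⟩
      K * (h * σ)  ≡⟨ regroup K h σ ⟩
      h * (σ * K)  ≤⟨ *-monoʳ-≤ h σK≤a ⟩
      h * a        ∎
      where
      open ≤-Reasoning
      regroup : ∀ K h σ → K * (h * σ) ≡ h * (σ * K)
      regroup = solve-∀

    remainder-bound : ∀ {r} → r < K → r ≤ suc σ * k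
    remainder-bound {r} r<K = ≤-pred (begin
      suc r            ≤⟨ r<K ⟩
      K                ≡⟨ K≡ ⟩
      σ * k + t        ≤⟨ +-monoʳ-≤ (σ * k) t≤1+k ⟩
      σ * k + suc k    ≡⟨ +-suc (σ * k) k ⟩
      suc (σ * k + k)  ≡⟨ cong suc (+-comm (σ * k) k) ⟩
      suc (suc σ * k)  ∎)
      where open ≤-Reasoning

    next-level : ∀ s {r} → s * k < r → suc s * k < r + k
    next-level s {r} sk<r = subst (_< r + k) (+-comm (s * k) k) (+-monoˡ-< k sk<r)

    +2≤⇒<pred : ∀ {m n} → m + 2 ≤ n → m < pred n
    +2≤⇒<pred {m} {n} m+2≤n = pred-mono-≤ (subst (_≤ n) (+-comm m 2) m+2≤n)

    cost-≤ : ∀ e c {c′ v v′} → e + c ≤ c′ → v ≤ e * K + v′ → c * h * a + v * d ≤ c′ * h * a + v′ * d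
    cost-≤ e c {c′} {v} {v′} e+c≤c′ v≤ = begin
      c * h * a + v * d                ≤⟨ +-monoʳ-≤ (c * h * a) (*-monoˡ-≤ d v≤) ⟩
      c * h * a + (e * K + v′) * d     ≡⟨ regroup c h a e K v′ d ⟩
      c * h * a + e * (K * d) + v′ * d ≤⟨ +-monoˡ-≤ (v′ * d) (+-monoʳ-≤ (c * h * a) (*-monoʳ-≤ e Kd≤ha)) ⟩
      c * h * a + e * (h * a) + v′ * d ≡⟨ regroup′ c h a e (v′ * d) ⟩
      (e + c) * h * a + v′ * d         ≤⟨ +-monoˡ-≤ (v′ * d) (*-monoˡ-≤ a (*-monoˡ-≤ h e+c≤c′)) ⟩
      c′ * h * a + v′ * d              ∎
      where
      open ≤-Reasoning
      regroup : ∀ c h a e K v d → c * h * a + (e * K + v) * d ≡ c * h * a + e * (K * d) + v * d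
      regroup = solve-∀
      regroup′ : ∀ c h a e x → c * h * a + e * (h * a) + x ≡ (e + c) * h * a + x
      regroup′ = solve-∀

    division : ∀ n → n ≡ n / K * K + n % K
    division n = trans (m≡m%n+[m/n]*n n K) (+-comm (n % K) (n / K * K))

    residues-covered : ∀ {M w} → Q + σ ≤ M → Q * K ≤ suc w →
      (∀ r → r < j → Σ ℕ λ c → r ≤ c * k × (Q + c) * h * a + (Q * K + r) * d ≤ M * h * a + w * d) →
      ResiduesCovered M w
    residues-covered {M} {w} Q+σ≤M QK≤1+w last-block w′ w′<a with w′ / K <? Q
    ... | yes q<Q =
      w′ / K , w′ % K , suc σ , division w′ , remainder-bound (m%n<n w′ K) , cost-≤ 0 (w′ / K + suc σ) q+σ+1≤M w′≤w
      where
      q+σ+1≤M : w′ / K + suc σ ≤ M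
      q+σ+1≤M = ≤-trans (≤-reflexive (+-suc (w′ / K) σ)) (≤-trans (+-monoˡ-≤ σ q<Q) Q+σ≤M)
      w′≤w : w′ ≤ w
      w′≤w = ≤-pred (begin
        suc w′                        ≡⟨ cong suc (division w′) ⟩
        suc (w′ / K * K + w′ % K)     ≤⟨ +-monoʳ-< (w′ / K * K) (m%n<n w′ K) ⟩
        w′ / K * K + K                ≡⟨ +-comm (w′ / K * K) K ⟩
        suc (w′ / K) * K              ≤⟨ *-monoˡ-≤ K q<Q ⟩
        Q * K                         ≤⟨ QK≤1+w ⟩
        suc w                         ∎)
        where open ≤-Reasoning
    ... | no q≮Q =
      let c , r≤ck , cost≤ = last-block (w′ % K) r<j
      in Q , w′ % K , c , w′≡ , r≤ck , subst (λ v → (Q + c) * h * a + v * d ≤ M * h * a + w * d) (sym w′≡) cost≤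
      where
      open ≤-Reasoning
      q<1+Q : w′ / K < suc Q
      q<1+Q = *-cancelʳ-< K (w′ / K) (suc Q) (begin-strict
        w′ / K * K             ≤⟨ m≤m+n (w′ / K * K) (w′ % K) ⟩
        w′ / K * K + w′ % K    ≡⟨ division w′ ⟨
        w′                     <⟨ w′<a ⟩
        a                      ≡⟨ a≡ ⟩
        j + Q * K              <⟨ +-monoˡ-< (Q * K) j<K ⟩
        suc Q * K              ∎)
      w′≡ : w′ ≡ Q * K + w′ % K
      w′≡ = trans (division w′) (cong (λ q → q * K + w′ % K) (≤-antisym (≤-pred q<1+Q) (≮⇒≥ q≮Q)))
      r<j : w′ % K < j
      r<j = +-cancelˡ-< (Q * K) (w′ % K) j (begin-strict
        Q * K + w′ % K  ≡⟨ w′≡ ⟨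
        w′              <⟨ w′<a ⟩
        a               ≡⟨ a≡ ⟩
        j + Q * K       ≡⟨ +-comm j (Q * K) ⟩
        Q * K + j       ∎)

    frobenius-at : ∀ M w {N} → M * h * a + suc w * d ≡ N → 1 ≤ M → w < a → ResiduesCovered M w → NeedsAtLeast M w →
      M * K < w + a + K → Σ ℕ λ G → G + a + d ≡ N × IsFrobeniusNumber (A a h d k K) (ℤ.+ G)
    frobenius-at M w N≡ 1≤M w<a covered needs MK< =
      G , trans (cong (_+ d) G+a≡) (trans (regroup (M * h * a) w d) N≡) , frobenius-criterion {G} {M} {w} G+a≡ w<a covered needs MK<
      where
      G : ℕ
      G = M * h * a + w * d ∸ a
      a≤Mha : a ≤ M * h * a
      a≤Mha = subst (_≤ M * h * a) (*-identityˡ a) (*-monoˡ-≤ a (*-mono-≤ 1≤M 1≤h))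
      G+a≡ : G + a ≡ M * h * a + w * d
      G+a≡ = m∸n+n≡m (≤-trans a≤Mha (m≤m+n (M * h * a) (w * d)))
      regroup : ∀ x w d → x + w * d + d ≡ x + suc w * d
      regroup = solve-∀

    1≤Q+σ : 1 ≤ Q + σ
    1≤Q+σ = ≤-trans (s≤s z≤n) (m≤n+m σ Q)

    Q-nonZero : NonZero Q
    Q-nonZero = >-nonZero (*-cancelʳ-< K 0 Q (+-cancelˡ-< j 0 (Q * K) (begin-strict
      j + 0      ≡⟨ +-identityʳ j ⟩
      j          <⟨ j<K ⟩
      K          ≤⟨ K≤a ⟩
      a          ≡⟨ a≡ ⟩
      j + Q * K  ∎)))
      where open ≤-Reasoning

    frobenius-low : j ≤ σ₀ * k + 1 →
      Σ ℕ λ G → G + a + d ≡ (Q + σ) * h * a + K * d * Q × IsFrobeniusNumber (A a h d k K) (ℤ.+ G)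
    frobenius-low j≤σ₀k+1 = frobenius-at (Q + σ) w N≡ 1≤Q+σ w<a covered needs MK<
      where
      w : ℕ
      w = pred Q * K + pred K
      QK≡1+w : Q * K ≡ suc w
      QK≡1+w = begin
        Q * K                      ≡⟨ cong (_* K) (suc-pred Q {{Q-nonZero}}) ⟨
        suc (pred Q) * K           ≡⟨ +-comm K (pred Q * K) ⟩
        pred Q * K + K             ≡⟨ cong (pred Q * K +_) (suc-pred K) ⟨
        pred Q * K + suc (pred K)  ≡⟨ +-suc (pred Q * K) (pred K) ⟩
        suc w                      ∎
        where open ≡-Reasoning
      N≡ : (Q + σ) * h * a + suc w * d ≡ (Q + σ) * h * a + K * d * Q
      N≡ = cong (λ v → (Q + σ) * h * a + v) (trans (cong (_* d) (sym QK≡1+w)) (regroup Q K d))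
        where
        regroup : ∀ Q K d → Q * K * d ≡ K * d * Q
        regroup = solve-∀
      w<a : w < a
      w<a = ≤-trans (≤-reflexive (sym QK≡1+w)) (≤-trans (m≤n+m (Q * K) j) (≤-reflexive (sym a≡)))
      covered : ResiduesCovered (Q + σ) w
      covered = residues-covered ≤-refl (≤-reflexive QK≡1+w) λ r r<j →
        σ₀ , <-≤+1⇒≤ r<j j≤σ₀k+1 ,
        cost-≤ 1 (Q + σ₀) (≤-reflexive (sym (+-suc Q σ₀))) (QK+r≤K+w (<-trans r<j j<K))
        where
        QK+r≤K+w : ∀ {r} → r < K → Q * K + r ≤ 1 * K + w
        QK+r≤K+w {r} r<K = ≤-pred (begin
          suc (Q * K + r)  ≤⟨ +-monoʳ-< (Q * K) r<K ⟩
          Q * K + K        ≡⟨ cong (_+ K) QK≡1+w ⟩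
          suc (w + K)      ≡⟨ cong suc (trans (+-comm w K) (cong (_+ w) (sym (*-identityˡ K)))) ⟩
          suc (1 * K + w)  ∎)
          where open ≤-Reasoning
      needs : NeedsAtLeast (Q + σ) w
      needs y z W W≤zk eq = subst (_≤ z + y) (trans (+-suc (pred Q) σ) (cong (_+ σ) (suc-pred Q {{Q-nonZero}})))
        (steps-lower-bound (pred Q) (pred K) (suc σ) k≤K (≤-reflexive (suc-pred K)) (next-level σ (+2≤⇒<pred σk+2≤K))
          y z W W≤zk eq)
      MK< : (Q + σ) * K < w + a + K
      MK< = begin-strict
        (Q + σ) * K      ≡⟨ *-distribʳ-+ K Q σ ⟩
        Q * K + σ * K    ≤⟨ +-monoʳ-≤ (Q * K) σK≤a ⟩
        Q * K + a        ≡⟨ cong (_+ a) QK≡1+w ⟩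
        suc (w + a)      <⟨ subst (_≤ w + a + K) (+-comm (w + a) 2) (+-monoʳ-≤ (w + a) 2≤K) ⟩
        w + a + K        ∎
        where open ≤-Reasoning

    module _ .{{_ : NonZero j}} where

      w : ℕ
      w = Q * K + pred j

      1+w≡a : suc w ≡ a
      1+w≡a = trans (sym (+-suc (Q * K) (pred j))) (trans (cong (Q * K +_) (suc-pred j)) (trans (+-comm (Q * K) j) (sym a≡)))

      QK≤1+w : Q * K ≤ suc w
      QK≤1+w = ≤-trans (m≤m+n (Q * K) (pred j)) (n≤1+n w)

      QK+r≤w : ∀ {r} → r < j → Q * K + r ≤ w
      QK+r≤w r<j = +-monoʳ-≤ (Q * K) (≤-pred (subst (_ <_) (sym (suc-pred j)) r<j))

      N≡ : ∀ M → M * h * a + suc w * d ≡ M * h * a + K * d * Q + j * d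
      N≡ M = trans (cong (λ v → M * h * a + v * d) (trans 1+w≡a a≡)) (regroup (M * h * a) j Q K d)
        where
        regroup : ∀ x j Q K d → x + (j + Q * K) * d ≡ x + K * d * Q + j * d
        regroup = solve-∀

      frobenius-mid : σ₀ * k + 2 ≤ j → j ≤ σ * k + 1 →
        Σ ℕ λ G → G + a + d ≡ (Q + σ) * h * a + K * d * Q + j * d × IsFrobeniusNumber (A a h d k K) (ℤ.+ G)
      frobenius-mid σ₀k+2≤j j≤σk+1 = frobenius-at (Q + σ) w (N≡ (Q + σ)) 1≤Q+σ (≤-reflexive 1+w≡a) covered needs MK<
        where
        covered : ResiduesCovered (Q + σ) w
        covered = residues-covered ≤-refl QK≤1+w λ r r<j →
          σ , <-≤+1⇒≤ r<j j≤σk+1 , cost-≤ 0 (Q + σ) ≤-refl (QK+r≤w r<j)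
        needs : NeedsAtLeast (Q + σ) w
        needs = steps-lower-bound Q (pred j) σ k≤K (≤-<-trans pred[n]≤n j<K) (next-level σ₀ (+2≤⇒<pred σ₀k+2≤j))
        MK< : (Q + σ) * K < w + a + K
        MK< = begin-strict
          (Q + σ) * K      ≡⟨ *-distribʳ-+ K Q σ ⟩
          Q * K + σ * K    ≤⟨ +-mono-≤ (m≤m+n (Q * K) (pred j)) σK≤a ⟩
          w + a            <⟨ m<m+n (w + a) (≤-trans 1≤k k≤K) ⟩
          w + a + K        ∎
          where open ≤-Reasoning

      frobenius-high : σ * k + 2 ≤ j →
        Σ ℕ λ G → G + a + d ≡ suc (Q + σ) * h * a + K * d * Q + j * d × IsFrobeniusNumber (A a h d k K) (ℤ.+ G)
      frobenius-high σk+2≤j =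
        frobenius-at (suc (Q + σ)) w (N≡ (suc (Q + σ))) (s≤s z≤n) (≤-reflexive 1+w≡a) covered needs MK<
        where
        covered : ResiduesCovered (suc (Q + σ)) w
        covered = residues-covered (n≤1+n (Q + σ)) QK≤1+w λ r r<j →
          suc σ , remainder-bound (<-trans r<j j<K) , cost-≤ 0 (Q + suc σ) (≤-reflexive (+-suc Q σ)) (QK+r≤w r<j)
        needs : NeedsAtLeast (suc (Q + σ)) w
        needs y z W W≤zk eq = subst (_≤ z + y) (+-suc Q σ)
          (steps-lower-bound Q (pred j) (suc σ) k≤K (≤-<-trans pred[n]≤n j<K) (next-level σ (+2≤⇒<pred σk+2≤j))
            y z W W≤zk eq)
        MK< : suc (Q + σ) * K < w + a + K
        MK< = begin-strict
          suc (Q + σ) * K      ≡⟨ regroup K Q σ ⟩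
          Q * K + σ * K + K    ≤⟨ +-monoˡ-≤ K (+-monoʳ-≤ (Q * K) σK≤a) ⟩
          Q * K + a + K        <⟨ +-monoˡ-< K (+-monoˡ-< a (m<m+n (Q * K) (≤-<-trans z≤n (+2≤⇒<pred σk+2≤j)))) ⟩
          w + a + K            ∎
          where
          open ≤-Reasoning
          regroup : ∀ K Q σ → suc (Q + σ) * K ≡ Q * K + σ * K + K
          regroup = solve-∀

open import Data.Integer using (ℤ; +_; _+_; _-_; _*_)
import Data.Integer.Properties as ℤP
import Data.Integer.Tactic.RingSolver as ℤ-Ring
import Data.Nat as ℕ
import Data.Nat.Properties as ℕP
open import Data.Empty using (⊥-elim)
open import Data.Nat.Coprimality using (Coprime; gcd≡1⇒coprime)
open import Data.Nat.DivMod using (m≡m%n+[m/n]*n; m%n<n)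
open import Data.Product using (_,_)
open import Data.Sum using (inj₁; inj₂)
open import Relation.Binary.PropositionalEquality using (refl; sym; trans; cong; cong₂; subst; module ≡-Reasoning)

pos-suc-+ : ∀ m n → + ℕ.suc (m ℕ.+ n) ≡ + m + + n + + 1
pos-suc-+ m n = trans (cong +_ (ℕP.+-comm 1 (m ℕ.+ n))) (trans (ℤP.pos-+ (m ℕ.+ n) 1) (cong (_+ + 1) (ℤP.pos-+ m n)))

pos-+-suc : ∀ m n → + ℕ.suc (m ℕ.+ n) ≡ + m + + ℕ.suc n
pos-+-suc m n = trans (cong +_ (sym (ℕP.+-suc m n))) (ℤP.pos-+ m (ℕ.suc n))

pos-+-pred : ∀ m n → + (m ℕ.+ n) ≡ + m + + ℕ.suc n - + 1
pos-+-pred m n = trans (ℤP.pos-+ m n) (trans (shift (+ m) (+ n)) (cong (λ v → + m + v - + 1) (sym (ℤP.pos-+ 1 n))))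
  where
  shift : ∀ x y → x + y ≡ x + (+ 1 + y) - + 1
  shift = ℤ-Ring.solve-∀

pos-+-+ : ∀ G a d → + (G ℕ.+ a ℕ.+ d) ≡ + G + + a + + d
pos-+-+ G a d = trans (ℤP.pos-+ (G ℕ.+ a) d) (cong (_+ + d) (ℤP.pos-+ G a))

pos-level : ∀ M h a K d Q → + (M ℕ.* h ℕ.* a ℕ.+ K ℕ.* d ℕ.* Q) ≡ + M * + h * + a + + K * + d * + Q
pos-level M h a K d Q = trans (ℤP.pos-+ (M ℕ.* h ℕ.* a) (K ℕ.* d ℕ.* Q))
  (cong₂ _+_ (trans (ℤP.pos-* (M ℕ.* h) a) (cong (_* + a) (ℤP.pos-* M h)))
             (trans (ℤP.pos-* (K ℕ.* d) Q) (cong (_* + Q) (ℤP.pos-* K d))))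

value-with-residue : ∀ {G a d M h K Q j Mz} →
  G ℕ.+ a ℕ.+ d ≡ M ℕ.* h ℕ.* a ℕ.+ K ℕ.* d ℕ.* Q ℕ.+ j ℕ.* d → + M ≡ Mz →
  + G ≡ Mz * + h * + a + + K * + d * + Q - + a + (+ j - + 1) * + d
value-with-residue {G} {a} {d} {M} {h} {K} {Q} {j} G+a+d≡ refl = begin
  + G                                                        ≡⟨ cancel (+ G) (+ a) (+ d) ⟩
  + G + + a + + d - + a - + d                                ≡⟨ cong (λ v → v - + a - + d) (pos-+-+ G a d) ⟨
  + (G ℕ.+ a ℕ.+ d) - + a - + d                              ≡⟨ cong (λ v → + v - + a - + d) G+a+d≡ ⟩
  + (M ℕ.* h ℕ.* a ℕ.+ K ℕ.* d ℕ.* Q ℕ.+ j ℕ.* d) - + a - + d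
    ≡⟨ cong (λ v → v - + a - + d) (trans (ℤP.pos-+ _ (j ℕ.* d)) (cong₂ _+_ (pos-level M h a K d Q) (ℤP.pos-* j d))) ⟩
  + M * + h * + a + + K * + d * + Q + + j * + d - + a - + d  ≡⟨ regroup (+ M * + h * + a + + K * + d * + Q) (+ j) (+ a) (+ d) ⟩
  + M * + h * + a + + K * + d * + Q - + a + (+ j - + 1) * + d ∎
  where
  open ≡-Reasoning
  cancel : ∀ x y z → x ≡ x + y + z - y - z
  cancel = ℤ-Ring.solve-∀
  regroup : ∀ x j a d → x + j * d - a - d ≡ x - a + (j - + 1) * d
  regroup = ℤ-Ring.solve-∀

value-without-residue : ∀ {G a d M h K Q Mz} → G ℕ.+ a ℕ.+ d ≡ M ℕ.* h ℕ.* a ℕ.+ K ℕ.* d ℕ.* Q → + M ≡ Mz →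
  + G ≡ Mz * + h * + a + + K * + d * + Q - + a - + d
value-without-residue {G} {a} {d} {M} {h} {K} {Q} G+a+d≡ refl =
  trans (value-with-residue {G} {a} {d} {M} {h} {K} {Q} {0} (trans G+a+d≡ (sym (ℕP.+-identityʳ _))) refl)
        (regroup (+ M * + h * + a + + K * + d * + Q) (+ a) (+ d))
  where
  regroup : ∀ x a d → x - a + (+ 0 - + 1) * d ≡ x - a - d
  regroup = ℤ-Ring.solve-∀

FrobeniusFormula : (a h d k K σ : ℕ) .{{_ : NonZero K}} → ℤ → ℤ → Set
FrobeniusFormula a h d k K σ M M⁺ =
  let Q = + (a / K)
      j = a % K
      Frobenius = IsFrobeniusNumber (A a h d k K)
  in (j ≤ (σ ∸ 1) ℕ.* k ℕ.+ 1 → Frobenius (M * + h * + a + + K * + d * Q - + a - + d))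
     × ((σ ∸ 1) ℕ.* k ℕ.+ 2 ≤ j → j ≤ σ ℕ.* k ℕ.+ 1 → Frobenius (M * + h * + a + + K * + d * Q - + a + (+ j - + 1) * + d))
     -- j ≤ K ∸ 1 always holds; it only mirrors the paper's case ranges.
     × (σ ℕ.* k ℕ.+ 2 ≤ j → j ≤ K ∸ 1 → Frobenius (M⁺ * + h * + a + + K * + d * Q - + a + (+ j - + 1) * + d))

frobenius-formula : ∀ a h d k K σ t .{{_ : NonZero K}} → Coprime a d → 1 ≤ h → 1 ≤ k → 1 ≤ σ →
  K ≡ σ ℕ.* k ℕ.+ t → 2 ≤ t → t ≤ ℕ.suc k → ⌈ d / σ ⌉ ≤ h → σ ℕ.* K ≤ a →
  ∀ {M M⁺} → + (a / K ℕ.+ σ) ≡ M → + ℕ.suc (a / K ℕ.+ σ) ≡ M⁺ → FrobeniusFormula a h d k K σ M M⁺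
frobenius-formula a h d k K (ℕ.suc σ₀) t cop 1≤h 1≤k 1≤σ K≡ 2≤t t≤1+k ⌈d/σ⌉≤h σK≤a M≡ M⁺≡ =
  (λ low → let G , G≡ , frobenius = frobenius-low low in
           subst Frobenius (value-without-residue {h = h} {K = K} {Q = a / K} G≡ M≡) frobenius) ,
  (λ low high → let G , G≡ , frobenius = frobenius-mid {{nonZero σ₀ low}} low high in
                subst Frobenius (value-with-residue {h = h} {K = K} {Q = a / K} {j = a % K} G≡ M≡) frobenius) ,
  (λ low _ → let G , G≡ , frobenius = frobenius-high {{nonZero (ℕ.suc σ₀) low}} low in
             subst Frobenius (value-with-residue {h = h} {K = K} {Q = a / K} {j = a % K} G≡ M⁺≡) frobenius)
  where
  open Configuration a h d k K σ₀ t (a / K) (a % K) cop 1≤h 1≤k K≡ 2≤t t≤1+k (⌈/⌉≤⇒≤* 1≤σ ⌈d/σ⌉≤h) σK≤a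
         (m≡m%n+[m/n]*n a K) (m%n<n a K)
  Frobenius : ℤ → Set
  Frobenius = IsFrobeniusNumber (A a h d k K)
  nonZero : ∀ s → s ℕ.* k ℕ.+ 2 ≤ a % K → NonZero (a % K)
  nonZero s s*k+2≤j = ℕ.>-nonZero (ℕP.≤-trans (ℕ.s≤s ℕ.z≤n) (ℕP.≤-trans (ℕP.m≤n+m 2 (s ℕ.* k)) s*k+2≤j))

at-most-one : ∀ {t} → t ≡ 0 ⊎ t ≡ 1 → t ≤ 1
at-most-one (inj₁ refl) = ℕ.z≤n
at-most-one (inj₂ refl) = ℕ.s≤s ℕ.z≤n

level-at-least-two : ∀ {k K s′ t} → t ≤ 1 → k ℕ.+ 1 < K → K ≡ ℕ.suc s′ ℕ.* k ℕ.+ t → 1 ≤ s′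
level-at-least-two {s′ = ℕ.suc _} _ _ _ = ℕ.s≤s ℕ.z≤n
level-at-least-two {k} {s′ = ℕ.zero} t≤1 k+1<K refl =
  ⊥-elim (ℕP.<⇒≱ k+1<K (ℕP.+-mono-≤ (ℕP.≤-reflexive (ℕP.+-identityʳ k)) t≤1))

theorem4p8 : (a h d k K : ℕ) → 1 ≤ a → 1 ≤ h → 1 ≤ d → 1 ≤ k → 1 ≤ K →
  gcd a d ≡ 1 → k Data.Nat.+ 1 < K → 2 ≤ k →
  (s t : ℕ) → K ≡ s Data.Nat.* k Data.Nat.+ t → t ≤ k ∸ 1 → 1 ≤ s →
  .{{_ : NonZero K}} →
  let Q = a / K
      j = a % K
      Az = + a
      hz = + h
      dz = + d
      Kz = + K
      Qz = + Q
      sz = + s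
      jz = + j
  in
  ((2 ≤ t → h ≥ ⌈ d / s ⌉ → a ≥ s Data.Nat.* K →
    (j ≤ (s ∸ 1) Data.Nat.* k Data.Nat.+ 1 →
      IsFrobeniusNumber (A a h d k K) ((Qz + sz) * hz * Az + Kz * dz * Qz - Az - dz))
    × ((s ∸ 1) Data.Nat.* k Data.Nat.+ 2 ≤ j → j ≤ s Data.Nat.* k Data.Nat.+ 1 →
      IsFrobeniusNumber (A a h d k K) ((Qz + sz) * hz * Az + Kz * dz * Qz - Az + (jz - + 1) * dz))
    × (s Data.Nat.* k Data.Nat.+ 2 ≤ j → j ≤ K ∸ 1 →
      IsFrobeniusNumber (A a h d k K) ((Qz + sz + + 1) * hz * Az + Kz * dz * Qz - Az + (jz - + 1) * dz)))
  × ((t ≡ 0 ⊎ t ≡ 1) → h ≥ ⌈ d / (s ∸ 1) ⌉ → a ≥ (s ∸ 1) Data.Nat.* K →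
    (j ≤ (s ∸ 2) Data.Nat.* k Data.Nat.+ 1 →
      IsFrobeniusNumber (A a h d k K) ((Qz + sz - + 1) * hz * Az + Kz * dz * Qz - Az - dz))
    × ((s ∸ 2) Data.Nat.* k Data.Nat.+ 2 ≤ j → j ≤ (s ∸ 1) Data.Nat.* k Data.Nat.+ 1 →
      IsFrobeniusNumber (A a h d k K) ((Qz + sz - + 1) * hz * Az + Kz * dz * Qz - Az + (jz - + 1) * dz))
    × ((s ∸ 1) Data.Nat.* k Data.Nat.+ 2 ≤ j → j ≤ K ∸ 1 →
      IsFrobeniusNumber (A a h d k K) ((Qz + sz) * hz * Az + Kz * dz * Qz - Az + (jz - + 1) * dz))))
theorem4p8 _ _ _ _ _ _ _ _ _ _ _ _ _ ℕ.zero _ _ _ ()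
theorem4p8 a h d k K _ 1≤h _ 1≤k _ gcd≡1 k+1<K 2≤k (ℕ.suc s′) t K≡sk+t t≤k∸1 1≤s =
  (λ 2≤t ⌈d/s⌉≤h sK≤a →
    frobenius-formula a h d k K (ℕ.suc s′) t cop 1≤h 1≤k 1≤s K≡sk+t 2≤t t≤1+k ⌈d/s⌉≤h sK≤a
      (ℤP.pos-+ (a / K) (ℕ.suc s′)) (pos-suc-+ (a / K) (ℕ.suc s′))) ,
  (λ t∈01 ⌈d/s′⌉≤h s′K≤a →
    let t≤1 = at-most-one t∈01 in
    frobenius-formula a h d k K s′ (k ℕ.+ t) cop 1≤h 1≤k (level-at-least-two t≤1 k+1<K K≡sk+t) K≡s′k+k+t
      (ℕP.≤-trans 2≤k (ℕP.m≤m+n k t)) (ℕP.≤-trans (ℕP.+-monoʳ-≤ k t≤1) (ℕP.≤-reflexive (ℕP.+-comm k 1)))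
      ⌈d/s′⌉≤h s′K≤a (pos-+-pred (a / K) s′) (pos-+-suc (a / K) s′))
  where
  cop : Coprime a d
  cop = gcd≡1⇒coprime gcd≡1
  t≤1+k : t ≤ ℕ.suc k
  t≤1+k = ℕP.≤-trans t≤k∸1 (ℕP.≤-trans (ℕP.m∸n≤m k 1) (ℕP.n≤1+n k))
  K≡s′k+k+t : K ≡ s′ ℕ.* k ℕ.+ (k ℕ.+ t)
  K≡s′k+k+t = trans K≡sk+t (trans (cong (ℕ._+ t) (ℕP.+-comm k (s′ ℕ.* k))) (ℕP.+-assoc (s′ ℕ.* k) k t))
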